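{- Every non-special Gallai coloring of $K_5$ that uses exactly three colors and has no monochromatic vertex is isomorphic to one of the following five colorings of $K_5$ on vertex set $\{x_1,\dots,x_5\}$: (A) blue: $x_1x_5,x_1x_4,x_2x_3,x_2x_4,x_2x_5$; red: $x_1x_2,x_1x_3,x_3x_4,x_3x_5$; green: $x_4x_5$. (B) blue: $x_1x_3,x_1x_4,x_1x_5,x_2x_3,x_2x_4,x_2x_5$; red: $x_1x_2,x_3x_4,x_3x_5$; green: $x_4x_5$. (C) blue: $x_1x_3,x_1x_4,x_1x_5,x_2x_3,x_2x_4,x_2x_5$; red: $x_3x_4,x_3x_5$; green: $x_1x_2,x_4x_5$. (D) blue: $x_3x_4,x_3x_5$; red: $x_1x_3,x_1x_4,x_1x_5,x_2x_3,x_2x_4,x_2x_5,x_4x_5$; green: $x_1x_2$. (E) blue: $x_3x_4,x_4x_5,x_3x_5$; red: $x_1x_3,x_1x_4,x_1x_5,x_2x_3,x_2x_4,x_2x_5$; green: $x_1x_2$.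
   Context: A Gallai coloring of $K_m$ is a coloring $E(K_m)\to\{\text{red},\text{green},\text{blue}\}$ with no rainbow triangle (triangle whose three edges have three distinct colors). Two colorings are isomorphic if one is obtained from the other by relabeling vertices and permuting the colors. A vertex is monochromatic if all its incident edges have the same color. A coloring with exactly three colors is vertex-special if there is a vertex $v$ monochromatic in some color $c$ and the coloring of $K_m-v$ uses only the two colors other than $c$, with all its edges of one of them except exactly one edge of the other; it is edge-special if there are two non-adjacent edges of two different colors and all other edges have the third color; it is non-special if it is neither. -}

module Defs where

open import Data.Nat using (ℕ; _⊓_; _⊔_)
open import Data.Fin using (Fin; toℕ)
open import Data.Product using (Σ; ∃; ∃-syntax; _×_; _,_)
open import Data.Sum using (_⊎_)
open import Relation.Nullary using (¬_)
open import Relation.Binary.PropositionalEquality using (_≡_; _≢_)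
open import Function.Bundles using (_↔_; Inverse)

data Color : Set where
  red green blue : Color

-- A colouring of the edges of K_m on vertex set Fin m.  Only the values
-- c i j with i ≢ j are meaningful (the diagonal is ignored everywhere).
Coloring : ℕ → Set
Coloring m = Fin m → Fin m → Color

Symmetric : ∀ {m} → Coloring m → Set
Symmetric c = ∀ i j → i ≢ j → c i j ≡ c j i

AllDistinct : Color → Color → Color → Set
AllDistinct a b d = a ≢ b × b ≢ d × a ≢ d

Gallai : ∀ {m} → Coloring m → Set
Gallai c = ∀ i j k → i ≢ j → j ≢ k → i ≢ k → ¬ AllDistinct (c i j) (c j k) (c i k)

Uses : ∀ {m} → Coloring m → Color → Set
Uses c col = ∃[ i ] ∃[ j ] (i ≢ j × c i j ≡ col)

UsesExactlyThree : ∀ {m} → Coloring m → Set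
UsesExactlyThree c = Uses c red × Uses c green × Uses c blue

MonoVertexIn : ∀ {m} → Coloring m → Fin m → Color → Set
MonoVertexIn c v col = ∀ u → u ≢ v → c v u ≡ col

MonochromaticVertex : ∀ {m} → Coloring m → Fin m → Set
MonochromaticVertex c v = ∃[ col ] MonoVertexIn c v col

SameEdge : ∀ {m} → Fin m → Fin m → Fin m → Fin m → Set
SameEdge x y a b = (x ≡ a × y ≡ b) ⊎ (x ≡ b × y ≡ a)

VertexSpecial : ∀ {m} → Coloring m → Set
VertexSpecial {m} c =
  ∃[ v ] ∃[ col ] ∃[ d ] ∃[ e ] ∃[ a ] ∃[ b ]
    ( MonoVertexIn c v col
    × AllDistinct col d e
    × a ≢ b × a ≢ v × b ≢ v × c a b ≡ e
    × (∀ x y → x ≢ y → x ≢ v → y ≢ v → ¬ SameEdge x y a b → c x y ≡ d))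

EdgeSpecial : ∀ {m} → Coloring m → Set
EdgeSpecial {m} c =
  ∃[ a ] ∃[ b ] ∃[ a' ] ∃[ b' ] ∃[ col ]
    ( a ≢ b × a' ≢ b' × a ≢ a' × a ≢ b' × b ≢ a' × b ≢ b'
    × AllDistinct (c a b) (c a' b') col
    × (∀ x y → x ≢ y → ¬ SameEdge x y a b → ¬ SameEdge x y a' b' → c x y ≡ col))

NonSpecial : ∀ {m} → Coloring m → Set
NonSpecial c = ¬ VertexSpecial c × ¬ EdgeSpecial c

Isomorphic : ∀ {m} → Coloring m → Coloring m → Set
Isomorphic {m} c c' =
  Σ (Fin m ↔ Fin m) λ π → Σ (Color ↔ Color) λ σ →
    ∀ i j → i ≢ j →
      c' (Inverse.to π i) (Inverse.to π j) ≡ Inverse.to σ (c i j)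

-- build a symmetric colouring of K_5 from a table on pairs (p , q), p < q,
-- of 1-based vertex indices (x_p = vertex p - 1)
fromTable : (ℕ → ℕ → Color) → Coloring 5
fromTable f i j = f (Data.Nat.suc (toℕ i ⊓ toℕ j)) (Data.Nat.suc (toℕ i ⊔ toℕ j))

-- the diagonal (p = q) falls into the final catch-all and is irrelevant
tableA : ℕ → ℕ → Color
tableA 1 5 = blue
tableA 1 4 = blue
tableA 2 3 = blue
tableA 2 4 = blue
tableA 2 5 = blue
tableA 1 2 = red
tableA 1 3 = red
tableA 3 4 = red
tableA 3 5 = red
tableA 4 5 = green
tableA _ _ = red

tableB : ℕ → ℕ → Color
tableB 1 3 = blue
tableB 1 4 = blue
tableB 1 5 = blue
tableB 2 3 = blue
tableB 2 4 = blue
tableB 2 5 = blue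
tableB 1 2 = red
tableB 3 4 = red
tableB 3 5 = red
tableB 4 5 = green
tableB _ _ = red

tableC : ℕ → ℕ → Color
tableC 1 3 = blue
tableC 1 4 = blue
tableC 1 5 = blue
tableC 2 3 = blue
tableC 2 4 = blue
tableC 2 5 = blue
tableC 3 4 = red
tableC 3 5 = red
tableC 1 2 = green
tableC 4 5 = green
tableC _ _ = red

tableD : ℕ → ℕ → Color
tableD 3 4 = blue
tableD 3 5 = blue
tableD 1 3 = red
tableD 1 4 = red
tableD 1 5 = red
tableD 2 3 = red
tableD 2 4 = red
tableD 2 5 = red
tableD 4 5 = red
tableD 1 2 = green
tableD _ _ = red

tableE : ℕ → ℕ → Color
tableE 3 4 = blue
tableE 4 5 = blue
tableE 3 5 = blue
tableE 1 3 = red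
tableE 1 4 = red
tableE 1 5 = red
tableE 2 3 = red
tableE 2 4 = red
tableE 2 5 = red
tableE 1 2 = green
tableE _ _ = red

colA colB colC colD colE : Coloring 5
colA = fromTable tableA
colB = fromTable tableB
colC = fromTable tableC
colD = fromTable tableD
colE = fromTable tableE

-- Being rainbow-free is hereditary, so the Gallai colorings of K₅ arise from
-- those of K₄ by adding a vertex and discarding the extensions with a rainbow
-- triangle through it; this enumerates all 6129 of them.  Exactly 960 use all
-- three colors and have no monochromatic vertex, and for each of these a
-- search finds an explicit isomorphism onto one of (A)–(E).
module Submission where

open import Defs
open import Data.Fin using (Fin)
open import Data.Product using (_×_)
open import Data.Sum using (_⊎_)
open import Relation.Nullary using (¬_)

open import Data.Bool using (Bool; if_then_else_)
open import Data.Fin as Fin using (zero; suc)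
open import Data.Fin.Permutation using (Permutation′; lift₀; transpose; _∘ₚ_; _⟨$⟩ʳ_)
open import Data.Fin.Properties using (all?; any?; suc-injective)
open import Data.List as List using (List; []; _∷_; [_]; concatMap; cartesianProductWith; filter; map; length)
open import Data.List.Membership.Propositional using (_∈_)
open import Data.List.Membership.Propositional.Properties using (∈-cartesianProductWith⁺; ∈-concatMap⁺; ∈-filter⁺; ∈-map⁺)
open import Data.List.Relation.Unary.All as All using (All)
open import Data.List.Relation.Unary.Any as Any using (here; there)
open import Data.Maybe as Maybe using (Maybe; just; nothing; _<∣>_; from-just)
open import Data.Maybe.Effectful as Maybe using ()
open import Data.Nat as ℕ using (ℕ; zero; suc)
open import Data.Product using (_,_)
open import Data.Sum as Sum using (inj₁; inj₂)
open import Data.Vec using (Vec; []; _∷_; lookup; tabulate)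
open import Data.Vec.Properties using (lookup∘tabulate)
open import Function using (_∘_)
open import Function.Bundles using (_↔_; Inverse; mk↔ₛ′)
open import Function.Construct.Composition using (_↔-∘_)
open import Function.Construct.Symmetry using (↔-sym)
open import Level using (0ℓ)
open import Relation.Binary.Definitions using (DecidableEquality)
open import Relation.Binary.PropositionalEquality using (_≡_; refl; sym; trans; cong; _≢_)
open import Relation.Nullary using (Dec; yes; no; contradiction)
open import Relation.Nullary.Decidable using (⌊_⌋; ¬?; _×-dec_; _→-dec_; dec⇒maybe)

private
  variable
    m n : ℕ

_≟_ : DecidableEquality Color
red   ≟ red   = yes refl
green ≟ green = yes refl
blue  ≟ blue  = yes refl
red   ≟ green = no λ ()
red   ≟ blue  = no λ ()
green ≟ red   = no λ ()
green ≟ blue  = no λ ()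
blue  ≟ red   = no λ ()
blue  ≟ green = no λ ()

colors : List Color
colors = red ∷ green ∷ blue ∷ []

∈-colors : ∀ col → col ∈ colors
∈-colors red   = here refl
∈-colors green = there (here refl)
∈-colors blue  = there (there (here refl))

Color↔Fin3 : Color ↔ Fin 3
Color↔Fin3 = mk↔ₛ′ toFin fromFin toFin-fromFin fromFin-toFin
  where
  toFin : Color → Fin 3
  toFin red   = zero
  toFin green = suc zero
  toFin blue  = suc (suc zero)

  fromFin : Fin 3 → Color
  fromFin zero             = red
  fromFin (suc zero)       = green
  fromFin (suc (suc zero)) = blue

  toFin-fromFin : ∀ i → toFin (fromFin i) ≡ i
  toFin-fromFin zero             = refl
  toFin-fromFin (suc zero)       = refl
  toFin-fromFin (suc (suc zero)) = refl

  fromFin-toFin : ∀ col → fromFin (toFin col) ≡ col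
  fromFin-toFin red   = refl
  fromFin-toFin green = refl
  fromFin-toFin blue  = refl

infix 4 _≈_

_≈_ : Coloring m → Coloring m → Set
c ≈ d = ∀ i j → i ≢ j → c i j ≡ d i j

≈-sym : {c d : Coloring m} → c ≈ d → d ≈ c
≈-sym c≈d i j i≢j = sym (c≈d i j i≢j)

module _ {c d : Coloring m} (c≈d : c ≈ d) where

  Gallai-cong : Gallai c → Gallai d
  Gallai-cong gallai i j k i≢j j≢k i≢k
    rewrite sym (c≈d i j i≢j) | sym (c≈d j k j≢k) | sym (c≈d i k i≢k) = gallai i j k i≢j j≢k i≢k

  Uses-cong : ∀ {col} → Uses c col → Uses d col
  Uses-cong (i , j , i≢j , cij≡col) = i , j , i≢j , trans (sym (c≈d i j i≢j)) cij≡col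

  MonoVertexIn-cong : ∀ {v col} → MonoVertexIn c v col → MonoVertexIn d v col
  MonoVertexIn-cong {v} mono u u≢v = trans (sym (c≈d v u (u≢v ∘ sym))) (mono u u≢v)

  Isomorphic-cong : ∀ e → Isomorphic c e → Isomorphic d e
  Isomorphic-cong e (π , σ , iso) = π , σ , λ i j i≢j → trans (iso i j i≢j) (cong (Inverse.to σ) (c≈d i j i≢j))

data Table : ℕ → Set where
  []  : Table 0
  _▷_ : Table n → Vec Color n → Table (suc n)

-- The vertex added last is zero; the row lists its colors towards the others.
coloring : Table n → Coloring n
coloring (t ▷ row) zero    zero    = red
coloring (t ▷ row) zero    (suc j) = lookup row j
coloring (t ▷ row) (suc i) zero    = lookup row i
coloring (t ▷ row) (suc i) (suc j) = coloring t i j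

tableOf : Coloring n → Table n
tableOf {zero}  c = []
tableOf {suc n} c = tableOf (λ i j → c (suc i) (suc j)) ▷ tabulate (c zero ∘ suc)

coloring-tableOf : (c : Coloring n) → Symmetric c → coloring (tableOf c) ≈ c
coloring-tableOf c symmetric zero    zero    0≢0   = contradiction refl 0≢0
coloring-tableOf c symmetric zero    (suc j) _     = lookup∘tabulate (c zero ∘ suc) j
coloring-tableOf c symmetric (suc i) zero    _     =
  trans (lookup∘tabulate (c zero ∘ suc) i) (symmetric zero (suc i) λ ())
coloring-tableOf c symmetric (suc i) (suc j) si≢sj =
  coloring-tableOf (λ i j → c (suc i) (suc j))
    (λ i j i≢j → symmetric (suc i) (suc j) (i≢j ∘ suc-injective))
    i j (si≢sj ∘ cong suc)

vectors : {A : Set} → List A → (n : ℕ) → List (Vec A n)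
vectors xs zero    = [ [] ]
vectors xs (suc n) = cartesianProductWith _∷_ xs (vectors xs n)

vectors-complete : {A : Set} {xs : List A} → (∀ x → x ∈ xs) → (v : Vec A n) → v ∈ vectors xs n
vectors-complete ∈xs []      = here refl
vectors-complete ∈xs (x ∷ v) = ∈-cartesianProductWith⁺ _∷_ (∈xs x) (vectors-complete ∈xs v)

allDistinct? : ∀ a b d → Dec (AllDistinct a b d)
allDistinct? a b d = ¬? (a ≟ b) ×-dec ¬? (b ≟ d) ×-dec ¬? (a ≟ d)

RainbowFreeAt : Coloring m → Fin m → Set
RainbowFreeAt c i = ∀ j k → i ≢ j → j ≢ k → i ≢ k → ¬ AllDistinct (c i j) (c j k) (c i k)

rainbowFreeAt? : (c : Coloring m) (i : Fin m) → Dec (RainbowFreeAt c i)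
rainbowFreeAt? c i = all? λ j → all? λ k →
  ¬? (i Fin.≟ j) →-dec ¬? (j Fin.≟ k) →-dec ¬? (i Fin.≟ k) →-dec ¬? (allDistinct? (c i j) (c j k) (c i k))

Gallai-▷⁻ : ∀ {t : Table n} {row} → Gallai (coloring (t ▷ row)) → Gallai (coloring t)
Gallai-▷⁻ gallai i j k i≢j j≢k i≢k =
  gallai (suc i) (suc j) (suc k) (i≢j ∘ suc-injective) (j≢k ∘ suc-injective) (i≢k ∘ suc-injective)

rainbowFreeExtensions : Table n → List (Table (suc n))
rainbowFreeExtensions {n} t =
  filter (λ t′ → rainbowFreeAt? (coloring t′) zero) (map (t ▷_) (vectors colors n))

gallaiTables : (n : ℕ) → List (Table n)
gallaiTables zero    = [ [] ]
gallaiTables (suc n) = concatMap rainbowFreeExtensions (gallaiTables n)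

gallaiTables-complete : (t : Table n) → Gallai (coloring t) → t ∈ gallaiTables n
gallaiTables-complete []        _      = here refl
gallaiTables-complete (t ▷ row) gallai =
  ∈-concatMap⁺ rainbowFreeExtensions (Any.map extension (gallaiTables-complete t (Gallai-▷⁻ gallai)))
  where
  extension : ∀ {t′} → t ≡ t′ → t ▷ row ∈ rainbowFreeExtensions t′
  extension refl = ∈-filter⁺ _ (∈-map⁺ (t ▷_) (vectors-complete ∈-colors row)) (gallai zero)

uses? : (c : Coloring m) (col : Color) → Dec (Uses c col)
uses? c col = any? λ i → any? λ j → ¬? (i Fin.≟ j) ×-dec (c i j ≟ col)

monoVertexIn? : (c : Coloring m) (v : Fin m) (col : Color) → Dec (MonoVertexIn c v col)
monoVertexIn? c v col = all? λ u → ¬? (u Fin.≟ v) →-dec (c v u ≟ col)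

monochromaticVertex? : (c : Coloring m) (v : Fin m) → Dec (MonochromaticVertex c v)
monochromaticVertex? c v with monoVertexIn? c v red | monoVertexIn? c v green | monoVertexIn? c v blue
... | yes mono | _        | _        = yes (red , mono)
... | no _     | yes mono | _        = yes (green , mono)
... | no _     | no _     | yes mono = yes (blue , mono)
... | no ¬red  | no ¬green | no ¬blue = no λ where
  (red , mono)   → ¬red mono
  (green , mono) → ¬green mono
  (blue , mono)  → ¬blue mono

Candidate : Coloring m → Set
Candidate c = UsesExactlyThree c × (∀ v → ¬ MonochromaticVertex c v)

candidate? : (c : Coloring m) → Dec (Candidate c)
candidate? c =
  (uses? c red ×-dec uses? c green ×-dec uses? c blue) ×-dec all? (¬? ∘ monochromaticVertex? c)

Candidate-cong : {c d : Coloring m} → c ≈ d → Candidate c → Candidate d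
Candidate-cong c≈d ((usesRed , usesGreen , usesBlue) , noMono) =
  (Uses-cong c≈d usesRed , Uses-cong c≈d usesGreen , Uses-cong c≈d usesBlue) ,
  λ v (col , mono) → noMono v (col , MonoVertexIn-cong (≈-sym c≈d) mono)

permutations : (n : ℕ) → List (Permutation′ n)
permutations zero    = [ mk↔ₛ′ (λ ()) (λ ()) (λ ()) (λ ()) ]
permutations (suc n) =
  cartesianProductWith (λ k π → lift₀ π ∘ₚ transpose zero k) (List.allFin (suc n)) (permutations n)

colorPermutations : List (Color ↔ Color)
colorPermutations = map (λ π → ↔-sym Color↔Fin3 ↔-∘ (π ↔-∘ Color↔Fin3)) (permutations 3)

colorClassSize : Coloring m → Color → ℕ
colorClassSize {m} c col = length (filter (λ (i , j) → (i Fin.<? j) ×-dec (c i j ≟ col))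
                                          (List.cartesianProduct (List.allFin m) (List.allFin m)))

firstJust : {A B : Set} → (A → Maybe B) → List A → Maybe B
firstJust f = List.foldr (λ x rest → f x <∣> rest) nothing

findIso : (c d : Coloring m) → Maybe (Isomorphic c d)
findIso {m} c d = firstJust (λ σ → if sizesMatch σ then firstJust (isoVia σ) (permutations m) else nothing)
                            colorPermutations
  where
  -- Only prunes the search: an isomorphism maps color classes onto color classes.
  sizesMatch : Color ↔ Color → Bool
  sizesMatch σ = ⌊ All.all? (λ col → colorClassSize c col ℕ.≟ colorClassSize d (Inverse.to σ col)) colors ⌋

  isoVia : Color ↔ Color → Permutation′ m → Maybe (Isomorphic c d)
  isoVia σ π = Maybe.map (λ iso → π , σ , iso) (dec⇒maybe
    (all? λ i → all? λ j → ¬? (i Fin.≟ j) →-dec (d (π ⟨$⟩ʳ i) (π ⟨$⟩ʳ j) ≟ Inverse.to σ (c i j))))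

OneOfABCDE : Coloring 5 → Set
OneOfABCDE c = Isomorphic c colA ⊎ Isomorphic c colB ⊎ Isomorphic c colC ⊎ Isomorphic c colD ⊎ Isomorphic c colE

OneOfABCDE-cong : {c d : Coloring 5} → c ≈ d → OneOfABCDE c → OneOfABCDE d
OneOfABCDE-cong {c} {d} c≈d =
  Sum.map (iso colA) (Sum.map (iso colB) (Sum.map (iso colC) (Sum.map (iso colD) (iso colE))))
  where
  iso : ∀ e → Isomorphic c e → Isomorphic d e
  iso = Isomorphic-cong c≈d

findOneOfABCDE : (c : Coloring 5) → Maybe (OneOfABCDE c)
findOneOfABCDE c = Maybe.map inj₁ (findIso c colA)
               <∣> Maybe.map (inj₂ ∘ inj₁) (findIso c colB)
               <∣> Maybe.map (inj₂ ∘ inj₂ ∘ inj₁) (findIso c colC)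
               <∣> Maybe.map (inj₂ ∘ inj₂ ∘ inj₂ ∘ inj₁) (findIso c colD)
               <∣> Maybe.map (inj₂ ∘ inj₂ ∘ inj₂ ∘ inj₂) (findIso c colE)

classify : (c : Coloring 5) → Maybe (Candidate c → OneOfABCDE c)
classify c with candidate? c
... | yes _         = Maybe.map (λ oneOf _ → oneOf) (findOneOfABCDE c)
... | no ¬candidate = just λ candidate → contradiction candidate ¬candidate

-- Established by evaluation: from-just has this type only if every search succeeds.
classification : All (λ t → Candidate (coloring t) → OneOfABCDE (coloring t)) (gallaiTables 5)
classification =
  from-just (All.sequenceA 0ℓ Maybe.applicative (All.universal (classify ∘ coloring) (gallaiTables 5)))

lemma4p5 : (c : Coloring 5) → Symmetric c → Gallai c → UsesExactlyThree c
    → NonSpecial c → (∀ v → ¬ MonochromaticVertex c v)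
    → Isomorphic c colA ⊎ Isomorphic c colB ⊎ Isomorphic c colC
    ⊎ Isomorphic c colD ⊎ Isomorphic c colE
lemma4p5 c symmetric gallai uses _ noMono =
  OneOfABCDE-cong table≈c (All.lookup classification table∈ (Candidate-cong c≈table (uses , noMono)))
  where
  table≈c : coloring (tableOf c) ≈ c
  table≈c = coloring-tableOf c symmetric

  c≈table : c ≈ coloring (tableOf c)
  c≈table = ≈-sym table≈c

  table∈ : tableOf c ∈ gallaiTables 5
  table∈ = gallaiTables-complete (tableOf c) (Gallai-cong c≈table gallai)
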